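{- Let $n=2m$ be an even positive integer, and let $X$ be a Seidel matrix chosen uniformly at random among the $2^{\binom n2}$ Seidel matrices of tournaments of order $n$. Then $\mathbb{E}(\det X)=(n-1)!!$.
   Context: A tournament of order $n$ is a digraph on $\{1,\dots,n\}$ with exactly one of the arcs $ij$, $ji$ for each pair $i\ne j$. Its Seidel matrix $S=[s_{ij}]$ is the $n\times n$ skew-symmetric matrix with zero diagonal, $s_{ij}=1$ if $ij$ is an arc and $s_{ij}=-1$ otherwise. Equivalently, a uniformly random Seidel matrix has independent entries $s_{ij}$, $i<j$, each equal to $\pm1$ with probability $1/2$. The double factorial is defined by $0!!=1!!=1$ and $n!!=n\cdot(n-2)!!$ for $n\ge 2$. -}

module Defs where

open import Data.Nat using (ℕ; zero; suc)
import Data.Nat as ℕ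
open import Data.Integer using (ℤ; +_; -_; _+_; _*_; -1ℤ; 0ℤ; 1ℤ)
open import Data.Bool using (Bool; true; false)
open import Data.Fin using (Fin; zero; suc; punchIn)
open import Data.Vec using (Vec; []; _∷_; lookup)
open import Data.List using (List; []; _∷_; map; concatMap; sum; foldr)
open import Data.Product using (_×_; _,_)

Matrix : ℕ → Set
Matrix n = Fin n → Fin n → ℤ

altSign : ∀ {n} → Fin n → ℤ
altSign zero    = 1ℤ
altSign (suc j) = - altSign j

sumFin : ∀ n → (Fin n → ℤ) → ℤ
sumFin zero    f = 0ℤ
sumFin (suc n) f = f zero + sumFin n (λ j → f (suc j))

minor : ∀ {n} → Matrix (suc n) → Fin (suc n) → Matrix n
minor A j r c = A (suc r) (punchIn j c)

det : ∀ n → Matrix n → ℤ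
det zero    A = 1ℤ
det (suc n) A = sumFin (suc n) (λ j → altSign j * A zero j * det n (minor A j))

-- Tournament (suc n): a tournament on the vertices 1..n (encoded as `suc`)
-- together with, for each of those vertices v, a bit saying whether the arc
-- goes from vertex 0 to v (true) or from v to vertex 0 (false).
-- This is in bijection with the 2^(n choose 2) tournaments on n labelled vertices.
data Tournament : ℕ → Set where
  []  : Tournament zero
  _∷_ : ∀ {n} → Vec Bool n → Tournament n → Tournament (suc n)

-- arc T i j : true iff ij is an arc (meaningful for i ≠ j).
arc : ∀ {n} → Tournament n → Fin n → Fin n → Bool
arc (v ∷ T) zero    zero    = false
arc (v ∷ T) zero    (suc j) = lookup v j
arc (v ∷ T) (suc i) zero    = Data.Bool.not (lookup v i)
arc (v ∷ T) (suc i) (suc j) = arc T i j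

seidel : ∀ {n} → Tournament n → Matrix n
seidel {suc n} (v ∷ T) zero    zero    = 0ℤ
seidel {suc n} (v ∷ T) (suc i) (suc j) = seidel T i j
seidel {suc n} T i j with arc T i j
... | true  = 1ℤ
... | false = -1ℤ

allVecs : ∀ n → List (Vec Bool n)
allVecs zero    = [] ∷ []
allVecs (suc n) = concatMap (λ v → (true ∷ v) ∷ (false ∷ v) ∷ []) (allVecs n)

-- All tournaments of order n (each exactly once; 2^(n choose 2) of them).
allTournaments : ∀ n → List (Tournament n)
allTournaments zero    = [] ∷ []
allTournaments (suc n) =
  concatMap (λ v → map (v ∷_) (allTournaments n)) (allVecs n)

_!! : ℕ → ℕ
zero !!          = 1
suc zero !!      = 1
suc (suc n) !!   = suc (suc n) ℕ.* (n !!)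

choose2 : ℕ → ℕ
choose2 zero    = 0
choose2 (suc n) = n ℕ.+ choose2 n

sumℤ : List ℤ → ℤ
sumℤ = foldr _+_ 0ℤ

{-# OPTIONS --safe #-}
module Submission where

-- A tournament of order n + 2 is a vertex 0 joined to a tournament T of order n + 1 by a
-- sign vector x ∈ {±1}ⁿ⁺¹, with s₀,ₖ₊₁ = xₖ and sₖ₊₁,₀ = −xₖ.  Expanding det S along row 0
-- and then column 0 gives det S = Σₖ,ᵣ xₖ xᵣ Cᵣₖ, where Cᵣₖ are the cofactors of S_T.
-- Summing over x kills the off-diagonal terms, because Σₓ xₖ xᵣ = 2ⁿ⁺¹ δₖᵣ, and the diagonal
-- cofactor Cₖₖ is the Seidel determinant of T with vertex k removed; every tournament of
-- order n arises in this way from exactly 2ⁿ tournaments T.  So the sum F(n) of det S over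
-- all tournaments of order n satisfies F(n + 2) = 2ⁿ⁺¹ (n + 1) 2ⁿ F(n), and
-- F(n) = 2^(n choose 2) (n − 1)!! for even n follows by induction.

import Algebra.Properties.Semiring.Sum as SemiringSum
open import Data.Bool using (Bool; true; false)
open import Data.Fin using (Fin; zero; suc; punchIn)
open import Data.Integer using (ℤ; +_; -_; _+_; _*_; 0ℤ; 1ℤ; -1ℤ)
import Data.Integer.Properties as ℤ
open import Data.Integer.Tactic.RingSolver using (solve-∀)
open import Data.List using (List; []; _∷_; _++_; map; concatMap)
import Data.Nat
open import Data.Nat as ℕ using (ℕ; zero; suc; _^_; _∸_)
import Data.Nat.Properties as ℕ
import Data.Nat.Tactic.RingSolver as ℕ-Solver
open import Data.Vec using (Vec; _∷_; lookup; removeAt)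
open import Relation.Binary.PropositionalEquality
  using (_≡_; refl; sym; trans; cong; cong₂; subst; module ≡-Reasoning)

open import Defs

open SemiringSum ℤ.+-*-semiring
  using (sum-syntax; sum-cong-≗; sum-replicate-zero; ∑-comm; *-distribˡ-sum)
open ≡-Reasoning

variable
  A B : Set
  n : ℕ

sumOver : List A → (A → ℤ) → ℤ
sumOver xs f = sumℤ (map f xs)

sumOver-cong : (xs : List A) {f g : A → ℤ} → (∀ x → f x ≡ g x) → sumOver xs f ≡ sumOver xs g
sumOver-cong []       f≗g = refl
sumOver-cong (x ∷ xs) f≗g = cong₂ _+_ (f≗g x) (sumOver-cong xs f≗g)

sumOver-zero : (xs : List A) → sumOver xs (λ _ → 0ℤ) ≡ 0ℤ
sumOver-zero []       = refl
sumOver-zero (x ∷ xs) = trans (ℤ.+-identityˡ _) (sumOver-zero xs)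

sumOver-distrib-+ : (xs : List A) (f g : A → ℤ) →
                    sumOver xs (λ x → f x + g x) ≡ sumOver xs f + sumOver xs g
sumOver-distrib-+ []       f g = refl
sumOver-distrib-+ (x ∷ xs) f g =
  trans (cong (_+_ (f x + g x)) (sumOver-distrib-+ xs f g)) (interchange (f x) (g x) _ _)
  where
  interchange : ∀ a b c d → a + b + (c + d) ≡ a + c + (b + d)
  interchange = solve-∀

*-distribˡ-sumOver : (c : ℤ) (xs : List A) (f : A → ℤ) →
                     c * sumOver xs f ≡ sumOver xs (λ x → c * f x)
*-distribˡ-sumOver c []       f = ℤ.*-zeroʳ c
*-distribˡ-sumOver c (x ∷ xs) f =
  trans (ℤ.*-distribˡ-+ c (f x) _) (cong (_+_ (c * f x)) (*-distribˡ-sumOver c xs f))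

sumOver-++ : (xs ys : List A) (f : A → ℤ) → sumOver (xs ++ ys) f ≡ sumOver xs f + sumOver ys f
sumOver-++ []       ys f = sym (ℤ.+-identityˡ _)
sumOver-++ (x ∷ xs) ys f =
  trans (cong (_+_ (f x)) (sumOver-++ xs ys f)) (sym (ℤ.+-assoc (f x) _ _))

sumOver-concatMap : (g : B → List A) (ys : List B) (f : A → ℤ) →
                    sumOver (concatMap g ys) f ≡ sumOver ys (λ y → sumOver (g y) f)
sumOver-concatMap g []       f = refl
sumOver-concatMap g (y ∷ ys) f =
  trans (sumOver-++ (g y) (concatMap g ys) f)
        (cong (_+_ (sumOver (g y) f)) (sumOver-concatMap g ys f))

sumOver-map : (g : B → A) (ys : List B) (f : A → ℤ) →
              sumOver (map g ys) f ≡ sumOver ys (λ y → f (g y))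
sumOver-map g []       f = refl
sumOver-map g (y ∷ ys) f = cong (_+_ (f (g y))) (sumOver-map g ys f)

sumOver-comm : (xs : List A) (ys : List B) (f : A → B → ℤ) →
               sumOver xs (λ x → sumOver ys (f x)) ≡ sumOver ys (λ y → sumOver xs (λ x → f x y))
sumOver-comm []       ys f = sym (sumOver-zero ys)
sumOver-comm (x ∷ xs) ys f =
  trans (cong (_+_ (sumOver ys (f x))) (sumOver-comm xs ys f))
        (sym (sumOver-distrib-+ ys (f x) (λ y → sumOver xs (λ x → f x y))))

sumOver-∑ : (xs : List A) (f : A → Fin n → ℤ) →
            sumOver xs (λ x → ∑[ k < n ] f x k) ≡ ∑[ k < n ] sumOver xs (λ x → f x k)
sumOver-∑ {n = zero}  xs f = sumOver-zero xs
sumOver-∑ {n = suc n} xs f = begin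
  sumOver xs (λ x → f x zero + ∑[ k < n ] f x (suc k))
    ≡⟨ sumOver-distrib-+ xs (λ x → f x zero) _ ⟩
  sumOver xs (λ x → f x zero) + sumOver xs (λ x → ∑[ k < n ] f x (suc k))
    ≡⟨ cong (_+_ (sumOver xs (λ x → f x zero))) (sumOver-∑ xs (λ x k → f x (suc k))) ⟩
  ∑[ k < suc n ] sumOver xs (λ x → f x k) ∎

∑-const : ∀ n (c : ℤ) → ∑[ k < n ] c ≡ + n * c
∑-const zero    c = refl
∑-const (suc n) c = trans (cong (_+_ c) (∑-const n c)) (sym (ℤ.suc-* (+ n) c))

δ : Fin n → Fin n → ℤ
δ zero    zero    = 1ℤ
δ zero    (suc _) = 0ℤ
δ (suc _) zero    = 0ℤ
δ (suc k) (suc r) = δ k r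

∑-δ : (k : Fin n) (f : Fin n → ℤ) → ∑[ r < n ] (f r * δ k r) ≡ f k
∑-δ {suc n} zero f = begin
  f zero * 1ℤ + ∑[ r < n ] (f (suc r) * 0ℤ)
    ≡⟨ cong₂ _+_ (ℤ.*-identityʳ (f zero)) (sum-cong-≗ (λ r → ℤ.*-zeroʳ (f (suc r)))) ⟩
  f zero + ∑[ r < n ] 0ℤ
    ≡⟨ cong (_+_ (f zero)) (sum-replicate-zero n) ⟩
  f zero + 0ℤ
    ≡⟨ ℤ.+-identityʳ (f zero) ⟩
  f zero ∎
∑-δ {suc n} (suc k) f =
  trans (cong (_+ ∑[ r < n ] (f (suc r) * δ k r)) (ℤ.*-zeroʳ (f zero)))
        (trans (ℤ.+-identityˡ _) (∑-δ k (λ r → f (suc r))))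

det-suc : ∀ n (A : Matrix (suc n)) →
          det (suc n) A ≡ ∑[ j < suc n ] (altSign j * A zero j * det n (minor A j))
det-suc n A = sumFin≡∑ (suc n) (λ j → altSign j * A zero j * det n (minor A j))
  where
  sumFin≡∑ : ∀ n (f : Fin n → ℤ) → sumFin n f ≡ ∑[ i < n ] f i
  sumFin≡∑ zero    f = refl
  sumFin≡∑ (suc n) f = cong (_+_ (f zero)) (sumFin≡∑ n (λ i → f (suc i)))

det-cong : ∀ n {A B : Matrix n} → (∀ i j → A i j ≡ B i j) → det n A ≡ det n B
det-cong zero    A≗B = refl
det-cong (suc n) {A} {B} A≗B = begin
  det (suc n) A
    ≡⟨ det-suc n A ⟩
  ∑[ j < suc n ] (altSign j * A zero j * det n (minor A j))
    ≡⟨ sum-cong-≗ (λ j → cong₂ (λ a d → altSign j * a * d) (A≗B zero j)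
                                 (det-cong n (λ r c → A≗B (suc r) (punchIn j c)))) ⟩
  ∑[ j < suc n ] (altSign j * B zero j * det n (minor B j))
    ≡⟨ det-suc n B ⟨
  det (suc n) B ∎

altSign-square : (k : Fin n) → altSign k * altSign k ≡ 1ℤ
altSign-square zero    = refl
altSign-square (suc k) = trans (neg-square (altSign k)) (altSign-square k)
  where
  neg-square : ∀ x → (- x) * (- x) ≡ x * x
  neg-square = solve-∀

lowerRight : Matrix (suc n) → Matrix n
lowerRight A i j = A (suc i) (suc j)

cofactor : Matrix (suc n) → Fin (suc n) → Fin (suc n) → ℤ
cofactor {n} A i j = altSign i * altSign j * det n (λ r c → A (punchIn i r) (punchIn j c))

cofactor-diagonal : (A : Matrix (suc n)) (k : Fin (suc n)) →
                    cofactor A k k ≡ det n (λ r c → A (punchIn k r) (punchIn k c))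
cofactor-diagonal A k =
  trans (cong (_* det _ (λ r c → A (punchIn k r) (punchIn k c))) (altSign-square k))
        (ℤ.*-identityˡ _)

det-expandFirstColumn : ∀ n (A : Matrix (suc n)) →
  det (suc n) A ≡ ∑[ r < suc n ] (altSign r * A r zero * det n (λ i j → A (punchIn r i) (suc j)))

det-bordered : ∀ n (A : Matrix (suc (suc n))) →
  det (suc (suc n)) A ≡
    A zero zero * det (suc n) (lowerRight A)
    + ∑[ k < suc n ] ∑[ r < suc n ] (- (A zero (suc k) * A (suc r) zero * cofactor (lowerRight A) r k))
det-bordered n A = begin
  det (suc (suc n)) A
    ≡⟨ det-suc (suc n) A ⟩
  1ℤ * a * det (suc n) (lowerRight A)
    + ∑[ k < suc n ] (- altSign k * u k * det (suc n) (minor A (suc k)))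
    ≡⟨ cong₂ _+_ (cong (_* det (suc n) (lowerRight A)) (ℤ.*-identityˡ a)) (sum-cong-≗ expandMinor) ⟩
  a * det (suc n) (lowerRight A)
    + ∑[ k < suc n ] ∑[ r < suc n ] (- (u k * w r * cofactor (lowerRight A) r k)) ∎
  where
  a = A zero zero
  u w : Fin (suc n) → ℤ
  u k = A zero (suc k)
  w r = A (suc r) zero
  regroup : ∀ a x b y m → - a * x * (b * y * m) ≡ - (x * y * (b * a * m))
  regroup = solve-∀
  expandMinor : ∀ k → - altSign k * u k * det (suc n) (minor A (suc k))
                      ≡ ∑[ r < suc n ] (- (u k * w r * cofactor (lowerRight A) r k))
  expandMinor k = begin
    - altSign k * u k * det (suc n) (minor A (suc k))
      ≡⟨ cong (_*_ (- altSign k * u k)) (det-expandFirstColumn n (minor A (suc k))) ⟩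
    - altSign k * u k * ∑[ r < suc n ] (altSign r * w r * M r)
      ≡⟨ *-distribˡ-sum (- altSign k * u k) (λ r → altSign r * w r * M r) ⟩
    ∑[ r < suc n ] (- altSign k * u k * (altSign r * w r * M r))
      ≡⟨ sum-cong-≗ (λ r → regroup (altSign k) (u k) (altSign r) (w r) (M r)) ⟩
    ∑[ r < suc n ] (- (u k * w r * cofactor (lowerRight A) r k)) ∎
    where
    M : Fin (suc n) → ℤ
    M r = det n (λ i j → A (suc (punchIn r i)) (suc (punchIn k j)))

det-expandFirstColumn zero    A = refl
det-expandFirstColumn (suc n) A = begin
  det (suc (suc n)) A
    ≡⟨ det-bordered n A ⟩
  a * det (suc n) (lowerRight A)
    + ∑[ k < suc n ] ∑[ r < suc n ] (- (u k * w r * cofactor (lowerRight A) r k))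
    ≡⟨ cong₂ _+_ (cong (_* det (suc n) (lowerRight A)) (sym (ℤ.*-identityˡ a))) borderTerms ⟩
  ∑[ r < suc (suc n) ] (altSign r * A r zero * det (suc n) (λ i j → A (punchIn r i) (suc j))) ∎
  where
  a = A zero zero
  u w : Fin (suc n) → ℤ
  u k = A zero (suc k)
  w r = A (suc r) zero
  M : Fin (suc n) → Fin (suc n) → ℤ
  M r k = det n (λ i j → A (suc (punchIn r i)) (suc (punchIn k j)))
  regroup : ∀ a x b y m → - (y * x * (a * b * m)) ≡ - a * x * (b * y * m)
  regroup = solve-∀
  borderTerms : ∑[ k < suc n ] ∑[ r < suc n ] (- (u k * w r * cofactor (lowerRight A) r k))
              ≡ ∑[ r < suc n ] (- altSign r * w r * det (suc n) (λ i j → A (punchIn (suc r) i) (suc j)))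
  borderTerms = begin
    ∑[ k < suc n ] ∑[ r < suc n ] (- (u k * w r * cofactor (lowerRight A) r k))
      ≡⟨ ∑-comm (λ k r → - (u k * w r * cofactor (lowerRight A) r k)) ⟩
    ∑[ r < suc n ] ∑[ k < suc n ] (- (u k * w r * cofactor (lowerRight A) r k))
      ≡⟨ sum-cong-≗ (λ r → sum-cong-≗ (λ k → regroup (altSign r) (w r) (altSign k) (u k) (M r k))) ⟩
    ∑[ r < suc n ] ∑[ k < suc n ] (- altSign r * w r * (altSign k * u k * M r k))
      ≡⟨ sum-cong-≗ (λ r → *-distribˡ-sum (- altSign r * w r) (λ k → altSign k * u k * M r k)) ⟨
    ∑[ r < suc n ] (- altSign r * w r * ∑[ k < suc n ] (altSign k * u k * M r k))
      ≡⟨ sum-cong-≗ (λ r → cong (_*_ (- altSign r * w r))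
                                 (det-suc n (λ i j → A (punchIn (suc r) i) (suc j)))) ⟨
    ∑[ r < suc n ] (- altSign r * w r * det (suc n) (λ i j → A (punchIn (suc r) i) (suc j))) ∎

sgn : Bool → ℤ
sgn true  = 1ℤ
sgn false = -1ℤ

sumOver-allVecs-suc : ∀ m (f : Vec Bool (suc m) → ℤ) →
  sumOver (allVecs (suc m)) f ≡ sumOver (allVecs m) (λ v → f (true ∷ v) + f (false ∷ v))
sumOver-allVecs-suc m f =
  trans (sumOver-concatMap _ (allVecs m) f)
        (sumOver-cong (allVecs m) (λ v → cong (_+_ (f (true ∷ v))) (ℤ.+-identityʳ (f (false ∷ v)))))

sumOver-allVecs-tail : ∀ m (f : Vec Bool (suc m) → ℤ) (g : Vec Bool m → ℤ) →
                       (∀ b v → f (b ∷ v) ≡ g v) →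
                       sumOver (allVecs (suc m)) f ≡ + 2 * sumOver (allVecs m) g
sumOver-allVecs-tail m f g f≗g = begin
  sumOver (allVecs (suc m)) f
    ≡⟨ sumOver-allVecs-suc m f ⟩
  sumOver (allVecs m) (λ v → f (true ∷ v) + f (false ∷ v))
    ≡⟨ sumOver-cong (allVecs m) (λ v → trans (cong₂ _+_ (f≗g true v) (f≗g false v)) (double (g v))) ⟩
  sumOver (allVecs m) (λ v → + 2 * g v)
    ≡⟨ *-distribˡ-sumOver (+ 2) (allVecs m) g ⟨
  + 2 * sumOver (allVecs m) g ∎
  where
  double : ∀ x → x + x ≡ + 2 * x
  double = solve-∀

sumOver-allVecs-cancel : ∀ m (f : Vec Bool (suc m) → ℤ) →
                         (∀ v → f (true ∷ v) + f (false ∷ v) ≡ 0ℤ) →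
                         sumOver (allVecs (suc m)) f ≡ 0ℤ
sumOver-allVecs-cancel m f cancel =
  trans (sumOver-allVecs-suc m f) (trans (sumOver-cong (allVecs m) cancel) (sumOver-zero (allVecs m)))

double-pow2-* : ∀ m x → + 2 * (+ (2 ^ m) * x) ≡ + (2 ^ suc m) * x
double-pow2-* m x = trans (sym (ℤ.*-assoc (+ 2) (+ (2 ^ m)) x)) (cong (_* x) (sym (ℤ.pos-* 2 (2 ^ m))))

sumOver-allVecs-const : ∀ m (c : ℤ) → sumOver (allVecs m) (λ _ → c) ≡ + (2 ^ m) * c
sumOver-allVecs-const zero    c = trans (ℤ.+-identityʳ c) (sym (ℤ.*-identityˡ c))
sumOver-allVecs-const (suc m) c =
  trans (sumOver-allVecs-tail m _ _ (λ _ _ → refl))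
        (trans (cong (_*_ (+ 2)) (sumOver-allVecs-const m c)) (double-pow2-* m c))

sgn-orthogonal : ∀ m (k r : Fin m) →
  sumOver (allVecs m) (λ v → sgn (lookup v k) * sgn (lookup v r)) ≡ + (2 ^ m) * δ k r
sgn-orthogonal (suc m) zero zero =
  trans (sumOver-allVecs-tail m _ (λ _ → 1ℤ) sgn-square)
        (trans (cong (_*_ (+ 2)) (sumOver-allVecs-const m 1ℤ)) (double-pow2-* m 1ℤ))
  where
  sgn-square : ∀ b (v : Vec Bool m) → sgn b * sgn b ≡ 1ℤ
  sgn-square true  v = refl
  sgn-square false v = refl
sgn-orthogonal (suc m) zero (suc r) =
  trans (sumOver-allVecs-cancel m _ (λ v → cancel (sgn (lookup v r))))
        (sym (ℤ.*-zeroʳ (+ (2 ^ suc m))))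
  where
  cancel : ∀ x → 1ℤ * x + -1ℤ * x ≡ 0ℤ
  cancel = solve-∀
sgn-orthogonal (suc m) (suc k) zero =
  trans (sumOver-allVecs-cancel m _ (λ v → cancel (sgn (lookup v k))))
        (sym (ℤ.*-zeroʳ (+ (2 ^ suc m))))
  where
  cancel : ∀ x → x * 1ℤ + x * -1ℤ ≡ 0ℤ
  cancel = solve-∀
sgn-orthogonal (suc m) (suc k) (suc r) =
  trans (sumOver-allVecs-tail m _ _ (λ _ _ → refl))
        (trans (cong (_*_ (+ 2)) (sgn-orthogonal m k r)) (double-pow2-* m (δ k r)))

sumOver-sgn-quadraticForm : ∀ m (c : Fin m → Fin m → ℤ) →
  sumOver (allVecs m) (λ v → ∑[ k < m ] ∑[ r < m ] (c r k * (sgn (lookup v k) * sgn (lookup v r))))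
    ≡ + (2 ^ m) * ∑[ k < m ] c k k
sumOver-sgn-quadraticForm m c = begin
  sumOver (allVecs m) (λ v → ∑[ k < m ] ∑[ r < m ] (c r k * x v k r))
    ≡⟨ sumOver-∑ (allVecs m) (λ v k → ∑[ r < m ] (c r k * x v k r)) ⟩
  ∑[ k < m ] sumOver (allVecs m) (λ v → ∑[ r < m ] (c r k * x v k r))
    ≡⟨ sum-cong-≗ (λ k → sumOver-∑ (allVecs m) (λ v r → c r k * x v k r)) ⟩
  ∑[ k < m ] ∑[ r < m ] sumOver (allVecs m) (λ v → c r k * x v k r)
    ≡⟨ sum-cong-≗ (λ k → sum-cong-≗ (λ r → *-distribˡ-sumOver (c r k) (allVecs m) (λ v → x v k r))) ⟨
  ∑[ k < m ] ∑[ r < m ] (c r k * sumOver (allVecs m) (λ v → x v k r))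
    ≡⟨ sum-cong-≗ (λ k → sum-cong-≗ (λ r →
         trans (cong (_*_ (c r k)) (sgn-orthogonal m k r)) (regroup (c r k) (+ (2 ^ m)) (δ k r)))) ⟩
  ∑[ k < m ] ∑[ r < m ] (+ (2 ^ m) * c r k * δ k r)
    ≡⟨ sum-cong-≗ (λ k → ∑-δ k (λ r → + (2 ^ m) * c r k)) ⟩
  ∑[ k < m ] (+ (2 ^ m) * c k k)
    ≡⟨ *-distribˡ-sum (+ (2 ^ m)) (λ k → c k k) ⟨
  + (2 ^ m) * ∑[ k < m ] c k k ∎
  where
  x : Vec Bool m → Fin m → Fin m → ℤ
  x v k r = sgn (lookup v k) * sgn (lookup v r)
  regroup : ∀ a p d → a * (p * d) ≡ p * a * d
  regroup = solve-∀

removeAt-∷-suc : (x : A) (xs : Vec A (suc n)) (k : Fin (suc n)) →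
                 removeAt (x ∷ xs) (suc k) ≡ x ∷ removeAt xs k
removeAt-∷-suc x (y ∷ ys) k = refl

lookup-removeAt : (xs : Vec A (suc n)) (k : Fin (suc n)) (j : Fin n) →
                  lookup (removeAt xs k) j ≡ lookup xs (punchIn k j)
lookup-removeAt (x ∷ xs)     zero    j       = refl
lookup-removeAt (x ∷ y ∷ xs) (suc k) zero    = refl
lookup-removeAt (x ∷ y ∷ xs) (suc k) (suc j) = lookup-removeAt (y ∷ xs) k j

sumOver-removeAt : ∀ n (k : Fin (suc n)) (g : Vec Bool n → ℤ) →
  sumOver (allVecs (suc n)) (λ w → g (removeAt w k)) ≡ + 2 * sumOver (allVecs n) g
sumOver-removeAt n       zero    g = sumOver-allVecs-tail n _ g (λ _ _ → refl)
sumOver-removeAt (suc n) (suc k) g = begin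
  sumOver (allVecs (suc (suc n))) (λ w → g (removeAt w (suc k)))
    ≡⟨ sumOver-allVecs-suc (suc n) _ ⟩
  sumOver V (λ v → g (removeAt (true ∷ v) (suc k)) + g (removeAt (false ∷ v) (suc k)))
    ≡⟨ sumOver-cong V (λ v → cong₂ _+_ (cong g (removeAt-∷-suc true v k))
                                        (cong g (removeAt-∷-suc false v k))) ⟩
  sumOver V (λ v → g₊ (removeAt v k) + g₋ (removeAt v k))
    ≡⟨ sumOver-distrib-+ V _ _ ⟩
  sumOver V (λ v → g₊ (removeAt v k)) + sumOver V (λ v → g₋ (removeAt v k))
    ≡⟨ cong₂ _+_ (sumOver-removeAt n k g₊) (sumOver-removeAt n k g₋) ⟩
  + 2 * sumOver (allVecs n) g₊ + + 2 * sumOver (allVecs n) g₋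
    ≡⟨ ℤ.*-distribˡ-+ (+ 2) (sumOver (allVecs n) g₊) (sumOver (allVecs n) g₋) ⟨
  + 2 * (sumOver (allVecs n) g₊ + sumOver (allVecs n) g₋)
    ≡⟨ cong (_*_ (+ 2)) (trans (sumOver-allVecs-suc n g) (sumOver-distrib-+ (allVecs n) g₊ g₋)) ⟨
  + 2 * sumOver (allVecs (suc n)) g ∎
  where
  V = allVecs (suc n)
  g₊ g₋ : Vec Bool n → ℤ
  g₊ u = g (true ∷ u)
  g₋ u = g (false ∷ u)

seidel-∷-row : (v : Vec Bool n) (T : Tournament n) (j : Fin n) →
               seidel (v ∷ T) zero (suc j) ≡ sgn (lookup v j)
seidel-∷-row v T j with lookup v j
... | true  = refl
... | false = refl

seidel-∷-column : (v : Vec Bool n) (T : Tournament n) (i : Fin n) →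
                  seidel (v ∷ T) (suc i) zero ≡ - sgn (lookup v i)
seidel-∷-column v T i with lookup v i
... | true  = refl
... | false = refl

det-seidel-∷ : (v : Vec Bool (suc n)) (T : Tournament (suc n)) →
  det (suc (suc n)) (seidel (v ∷ T)) ≡
    ∑[ k < suc n ] ∑[ r < suc n ] (cofactor (seidel T) r k * (sgn (lookup v k) * sgn (lookup v r)))
det-seidel-∷ {n} v T = begin
  det (suc (suc n)) (seidel (v ∷ T))
    ≡⟨ det-bordered n (seidel (v ∷ T)) ⟩
  0ℤ * det (suc n) (seidel T)
    + ∑[ k < suc n ] ∑[ r < suc n ] (- (S zero (suc k) * S (suc r) zero * cofactor (seidel T) r k))
    ≡⟨ ℤ.+-identityˡ _ ⟩
  ∑[ k < suc n ] ∑[ r < suc n ] (- (S zero (suc k) * S (suc r) zero * cofactor (seidel T) r k))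
    ≡⟨ sum-cong-≗ (λ k → sum-cong-≗ (λ r →
         trans (cong₂ (λ x y → - (x * y * cofactor (seidel T) r k))
                      (seidel-∷-row v T k) (seidel-∷-column v T r))
               (regroup (sgn (lookup v k)) (sgn (lookup v r)) (cofactor (seidel T) r k)))) ⟩
  ∑[ k < suc n ] ∑[ r < suc n ] (cofactor (seidel T) r k * (sgn (lookup v k) * sgn (lookup v r))) ∎
  where
  S = seidel (v ∷ T)
  regroup : ∀ x y c → - (x * - y * c) ≡ c * (x * y)
  regroup = solve-∀

removeVertex : Tournament (suc n) → Fin (suc n) → Tournament n
removeVertex         (v ∷ T) zero    = T
removeVertex {suc n} (v ∷ T) (suc k) = removeAt v k ∷ removeVertex T k

seidel-removeVertex : (T : Tournament (suc n)) (k : Fin (suc n)) (i j : Fin n) →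
                      seidel (removeVertex T k) i j ≡ seidel T (punchIn k i) (punchIn k j)
seidel-removeVertex         (v ∷ T) zero    i       j       = refl
seidel-removeVertex {suc n} (v ∷ T) (suc k) zero    zero    = refl
seidel-removeVertex {suc n} (v ∷ T) (suc k) zero    (suc j) =
  trans (seidel-∷-row (removeAt v k) (removeVertex T k) j)
        (trans (cong sgn (lookup-removeAt v k j)) (sym (seidel-∷-row v T (punchIn k j))))
seidel-removeVertex {suc n} (v ∷ T) (suc k) (suc i) zero    =
  trans (seidel-∷-column (removeAt v k) (removeVertex T k) i)
        (trans (cong (λ b → - sgn b) (lookup-removeAt v k i)) (sym (seidel-∷-column v T (punchIn k i))))
seidel-removeVertex {suc n} (v ∷ T) (suc k) (suc i) (suc j) = seidel-removeVertex T k i j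

sumOver-allTournaments-suc : ∀ n (f : Tournament (suc n) → ℤ) →
  sumOver (allTournaments (suc n)) f
    ≡ sumOver (allVecs n) (λ v → sumOver (allTournaments n) (λ T → f (v ∷ T)))
sumOver-allTournaments-suc n f =
  trans (sumOver-concatMap _ (allVecs n) f)
        (sumOver-cong (allVecs n) (λ v → sumOver-map (v ∷_) (allTournaments n) f))

sumOver-removeVertex : ∀ n (k : Fin (suc n)) (f : Tournament n → ℤ) →
  sumOver (allTournaments (suc n)) (λ T → f (removeVertex T k))
    ≡ + (2 ^ n) * sumOver (allTournaments n) f
sumOver-removeVertex n zero f =
  trans (sumOver-allTournaments-suc n _) (sumOver-allVecs-const n _)
sumOver-removeVertex (suc n) (suc k) f = begin
  sumOver (allTournaments (suc (suc n))) (λ T → f (removeVertex T (suc k)))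
    ≡⟨ sumOver-allTournaments-suc (suc n) _ ⟩
  sumOver V (λ w → sumOver Ts (λ T → f (removeAt w k ∷ removeVertex T k)))
    ≡⟨ sumOver-comm V Ts _ ⟩
  sumOver Ts (λ T → sumOver V (λ w → f (removeAt w k ∷ removeVertex T k)))
    ≡⟨ sumOver-cong Ts (λ T → sumOver-removeAt n k (λ u → f (u ∷ removeVertex T k))) ⟩
  sumOver Ts (λ T → + 2 * sumOver (allVecs n) (λ u → f (u ∷ removeVertex T k)))
    ≡⟨ *-distribˡ-sumOver (+ 2) Ts _ ⟨
  + 2 * sumOver Ts (λ T → sumOver (allVecs n) (λ u → f (u ∷ removeVertex T k)))
    ≡⟨ cong (_*_ (+ 2)) (sumOver-comm Ts (allVecs n) _) ⟩
  + 2 * sumOver (allVecs n) (λ u → sumOver Ts (λ T → f (u ∷ removeVertex T k)))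
    ≡⟨ cong (_*_ (+ 2)) (sumOver-cong (allVecs n) (λ u → sumOver-removeVertex n k (λ T → f (u ∷ T)))) ⟩
  + 2 * sumOver (allVecs n) (λ u → + (2 ^ n) * sumOver (allTournaments n) (λ T → f (u ∷ T)))
    ≡⟨ cong (_*_ (+ 2)) (*-distribˡ-sumOver (+ (2 ^ n)) (allVecs n) _) ⟨
  + 2 * (+ (2 ^ n) * sumOver (allVecs n) (λ u → sumOver (allTournaments n) (λ T → f (u ∷ T))))
    ≡⟨ cong (λ s → + 2 * (+ (2 ^ n) * s)) (sumOver-allTournaments-suc n f) ⟨
  + 2 * (+ (2 ^ n) * sumOver (allTournaments (suc n)) f)
    ≡⟨ double-pow2-* n _ ⟩
  + (2 ^ suc n) * sumOver (allTournaments (suc n)) f ∎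
  where
  V  = allVecs (suc n)
  Ts = allTournaments (suc n)

sumOver-det-seidel-∷ : ∀ n (T : Tournament (suc n)) →
  sumOver (allVecs (suc n)) (λ v → det (suc (suc n)) (seidel (v ∷ T)))
    ≡ + (2 ^ suc n) * ∑[ k < suc n ] det n (seidel (removeVertex T k))
sumOver-det-seidel-∷ n T = begin
  sumOver (allVecs (suc n)) (λ v → det (suc (suc n)) (seidel (v ∷ T)))
    ≡⟨ sumOver-cong (allVecs (suc n)) (λ v → det-seidel-∷ v T) ⟩
  sumOver (allVecs (suc n)) (λ v → ∑[ k < suc n ] ∑[ r < suc n ]
    (cofactor (seidel T) r k * (sgn (lookup v k) * sgn (lookup v r))))
    ≡⟨ sumOver-sgn-quadraticForm (suc n) (cofactor (seidel T)) ⟩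
  + (2 ^ suc n) * ∑[ k < suc n ] cofactor (seidel T) k k
    ≡⟨ cong (_*_ (+ (2 ^ suc n))) (sum-cong-≗ (λ k →
         trans (cofactor-diagonal (seidel T) k)
               (det-cong n (λ i j → sym (seidel-removeVertex T k i j))))) ⟩
  + (2 ^ suc n) * ∑[ k < suc n ] det n (seidel (removeVertex T k)) ∎

sumDet : ℕ → ℤ
sumDet n = sumOver (allTournaments n) (λ T → det n (seidel T))

sumDet-recurrence : ∀ n → sumDet (suc (suc n)) ≡ + (2 ^ suc n) * (+ (suc n) * (+ (2 ^ n) * sumDet n))
sumDet-recurrence n = begin
  sumDet (suc (suc n))
    ≡⟨ sumOver-allTournaments-suc (suc n) _ ⟩
  sumOver V (λ v → sumOver Ts (λ T → det (suc (suc n)) (seidel (v ∷ T))))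
    ≡⟨ sumOver-comm V Ts _ ⟩
  sumOver Ts (λ T → sumOver V (λ v → det (suc (suc n)) (seidel (v ∷ T))))
    ≡⟨ sumOver-cong Ts (sumOver-det-seidel-∷ n) ⟩
  sumOver Ts (λ T → + (2 ^ suc n) * ∑[ k < suc n ] det n (seidel (removeVertex T k)))
    ≡⟨ *-distribˡ-sumOver (+ (2 ^ suc n)) Ts _ ⟨
  + (2 ^ suc n) * sumOver Ts (λ T → ∑[ k < suc n ] det n (seidel (removeVertex T k)))
    ≡⟨ cong (_*_ (+ (2 ^ suc n))) (sumOver-∑ Ts (λ T k → det n (seidel (removeVertex T k)))) ⟩
  + (2 ^ suc n) * ∑[ k < suc n ] sumOver Ts (λ T → det n (seidel (removeVertex T k)))
    ≡⟨ cong (_*_ (+ (2 ^ suc n)))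
            (sum-cong-≗ (λ k → sumOver-removeVertex n k (λ T → det n (seidel T)))) ⟩
  + (2 ^ suc n) * ∑[ k < suc n ] (+ (2 ^ n) * sumDet n)
    ≡⟨ cong (_*_ (+ (2 ^ suc n))) (∑-const (suc n) _) ⟩
  + (2 ^ suc n) * (+ (suc n) * (+ (2 ^ n) * sumDet n)) ∎
  where
  V  = allVecs (suc n)
  Ts = allTournaments (suc n)

!!-suc : ∀ n → suc n !! ≡ suc n ℕ.* (n ∸ 1) !!
!!-suc zero    = refl
!!-suc (suc n) = refl

closedForm : ℕ → ℤ
closedForm n = + (2 ^ choose2 n ℕ.* (n ∸ 1) !!)

sumDet-step : ∀ n → sumDet n ≡ closedForm n → sumDet (suc (suc n)) ≡ closedForm (suc (suc n))
sumDet-step n sumDet≡ = begin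
  sumDet (suc (suc n))
    ≡⟨ sumDet-recurrence n ⟩
  + (2 ^ suc n) * (+ (suc n) * (+ (2 ^ n) * sumDet n))
    ≡⟨ cong (λ s → + (2 ^ suc n) * (+ (suc n) * (+ (2 ^ n) * s))) sumDet≡ ⟩
  + (2 ^ suc n) * (+ (suc n) * (+ (2 ^ n) * + (2 ^ c ℕ.* d)))
    ≡⟨ cong (λ z → + (2 ^ suc n) * (+ (suc n) * z)) (ℤ.pos-* (2 ^ n) (2 ^ c ℕ.* d)) ⟨
  + (2 ^ suc n) * (+ (suc n) * + (2 ^ n ℕ.* (2 ^ c ℕ.* d)))
    ≡⟨ cong (_*_ (+ (2 ^ suc n))) (ℤ.pos-* (suc n) (2 ^ n ℕ.* (2 ^ c ℕ.* d))) ⟨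
  + (2 ^ suc n) * + (suc n ℕ.* (2 ^ n ℕ.* (2 ^ c ℕ.* d)))
    ≡⟨ ℤ.pos-* (2 ^ suc n) (suc n ℕ.* (2 ^ n ℕ.* (2 ^ c ℕ.* d))) ⟨
  + (2 ^ suc n ℕ.* (suc n ℕ.* (2 ^ n ℕ.* (2 ^ c ℕ.* d))))
    ≡⟨ cong +_ (regroup (2 ^ suc n) (suc n) (2 ^ n) (2 ^ c) d) ⟩
  + (2 ^ suc n ℕ.* (2 ^ n ℕ.* 2 ^ c) ℕ.* (suc n ℕ.* d))
    ≡⟨ cong +_ (cong₂ ℕ._*_ powers (!!-suc n)) ⟨
  closedForm (suc (suc n)) ∎
  where
  c = choose2 n
  d = (n ∸ 1) !!
  regroup : ∀ a b x y z → a ℕ.* (b ℕ.* (x ℕ.* (y ℕ.* z))) ≡ a ℕ.* (x ℕ.* y) ℕ.* (b ℕ.* z)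
  regroup = ℕ-Solver.solve-∀
  powers : 2 ^ (suc n ℕ.+ (n ℕ.+ c)) ≡ 2 ^ suc n ℕ.* (2 ^ n ℕ.* 2 ^ c)
  powers = trans (ℕ.^-distribˡ-+-* 2 (suc n) (n ℕ.+ c)) (cong (2 ^ suc n ℕ.*_) (ℕ.^-distribˡ-+-* 2 n c))

sumDet-even : ∀ m → sumDet (2 ℕ.* m) ≡ closedForm (2 ℕ.* m)
sumDet-even zero    = refl
sumDet-even (suc m) =
  subst (λ n → sumDet n ≡ closedForm n) (sym (ℕ.*-suc 2 m)) (sumDet-step (2 ℕ.* m) (sumDet-even m))

theorem4p1 : (m : ℕ) → let n = 2 Data.Nat.* suc m in
    sumℤ (map (λ T → det n (seidel T)) (allTournaments n))
    ≡ + (2 ^ choose2 n) * + ((n ∸ 1) !!)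
theorem4p1 m =
  trans (sumDet-even (suc m)) (ℤ.pos-* (2 ^ choose2 (2 ℕ.* suc m)) ((2 ℕ.* suc m ∸ 1) !!))
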